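{- Let $n \geq 3$ and $m \geq 0$. Then $$A(n,m) = \big(A(n-1,m-1)\cdot (R_n\setminus\{e\})\big) \cup A(n-1,m),$$ and this union is disjoint. Here $X \cdot Y = \{xy \mid x \in X, y \in Y\}$, and $A(n-1,-1) = \emptyset$.
   Context: $A_n$ is the alternating group on $\{1,\dots,n\}$ under composition, and $e$ is the identity. $A_{n-1}$ is identified with the subgroup of $A_n$ fixing $n$. Set $T(A_n) = \{(1\,2)(i\,j) \mid 1 \le i<j \le n\}$, a generating set of $A_n$. The length $\ell_{T(A_n)}(v)$ of $v \in A_n$ is the minimal $k \geq 0$ such that $v$ is a product of $k$ elements of $T(A_n)$. Define $A(n,m) = \{v \in A_n \mid \ell_{T(A_n)}(v) = m\}$. Define $R_n = \{(1\,2)(j\,n) \mid 1 \le j < n\} \cup \{e\}$. -}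

module Defs where

open import Data.Nat using (ℕ; zero; suc; _+_; _<_)
import Data.Nat as ℕ
open import Data.Fin using (Fin; toℕ; inject₁; fromℕ; lower₁) renaming (_<_ to _<ᶠ_)
import Data.Fin as F
open import Data.List using (List; []; _∷_; foldr; length)
open import Data.List.Relation.Unary.All using (All)
open import Data.Product using (Σ; ∃; _×_; _,_)
open import Data.Empty using (⊥)
open import Relation.Nullary using (¬_; yes; no)
open import Relation.Binary.PropositionalEquality using (_≡_; _≢_; _≗_; sym)
open import Function using (_∘_; id)

-- Elements of the symmetric group on {1..N}, represented on Fin N
-- (point i+1 of the paper is the Fin element i).  Equality is pointwise (_≗_).
Perm : ℕ → Set
Perm N = Fin N → Fin N

_·_ : ∀ {N} → Perm N → Perm N → Perm N
x · y = x ∘ y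

-- the transposition (i j) (for i ≡ j it is the identity)
swap : ∀ {N} → Fin N → Fin N → Perm N
swap i j x with x F.≟ i
... | yes _ = j
... | no _ with x F.≟ j
...   | yes _ = i
...   | no _ = x

prod : ∀ {N} → List (Perm N) → Perm N
prod = foldr _·_ id

IsTransposition : ∀ {N} → Perm N → Set
IsTransposition {N} t = Σ (Fin N) λ i → Σ (Fin N) λ j → i ≢ j × (t ≗ swap i j)

data Even : ℕ → Set where
  ev0 : Even zero
  ev2 : ∀ {k} → Even k → Even (suc (suc k))

InAlt : ∀ {N} → Perm N → Set
InAlt {N} v = Σ (List (Perm N)) λ ts →
  All IsTransposition ts × Even (length ts) × (v ≗ prod ts)

one two : ∀ {k} → Fin (2 + k)
one = F.zero
two = F.suc F.zero

InT : ∀ {k} → Perm (2 + k) → Set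
InT {k} t = Σ (Fin (2 + k)) λ i → Σ (Fin (2 + k)) λ j →
  i <ᶠ j × (t ≗ (swap one two · swap i j))

TProd : ∀ {k} → ℕ → Perm (2 + k) → Set
TProd {k} m v = Σ (List (Perm (2 + k))) λ ts →
  length ts ≡ m × All InT ts × (v ≗ prod ts)

LengthIs : ∀ {k} → Perm (2 + k) → ℕ → Set
LengthIs v m = TProd m v × (∀ j → j < m → ¬ TProd j v)

-- A(N, m) = {v ∈ A_N | ℓ_T(v) = m}, with N = 2 + k
A : ∀ k → ℕ → Perm (2 + k) → Set
A k m v = InAlt v × LengthIs v m

-- embedding of Sym(N) into Sym(N+1) as the permutations fixing the last point
ι : ∀ {N} → Perm N → Perm (suc N)
ι {N} σ x with toℕ x ℕ.≟ N
... | yes _ = fromℕ N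
... | no p = inject₁ (σ (lower₁ x (p ∘ sym)))

-- R_n = {(1 2)(j n) | 1 ≤ j < n} ∪ {e}, for n = 3 + k
InR : ∀ {k} → Perm (3 + k) → Set
InR {k} r = (Σ (Fin (3 + k)) λ j → (j <ᶠ fromℕ (2 + k)) × (r ≗ (swap one two · swap j (fromℕ (2 + k)))))
          Data.Sum.⊎ (r ≗ id)
  where import Data.Sum

-- A(n-1, m-1) · (R_n ∖ {e}) as a subset of A_n (n = 3 + k), with A(n-1,-1) = ∅
LeftPart : ∀ k → ℕ → Perm (3 + k) → Set
LeftPart k zero v = ⊥
LeftPart k (suc m) v = Σ (Perm (2 + k)) λ x → Σ (Perm (3 + k)) λ r →
  A k m x × InR r × ¬ (r ≗ id) × (v ≗ (ι x · r))

-- A(n-1, m), identified with a subset of A_n via the embedding fixing n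
RightPart : ∀ k → ℕ → Perm (3 + k) → Set
RightPart k m v = Σ (Perm (2 + k)) λ x → A k m x × (v ≗ ι x)

-- Write (1 2)(c n) for the generators moving n.  The heart of the proof is a
-- normal form for products of generators of T(A_n) (`split`): a product of j
-- generators is either ι y with y a product of j generators of T(A_{n-1}), or
-- ι y · (1 2)(c n) with y a product of j - 1 of them.  It is proved by
-- induction on the word, multiplying on the left by one generator at a time:
-- an embedded generator is absorbed into y, while (1 2)(a n) is commuted past
-- ι y (turning y into its conjugate (1 2) y (1 2), which has the same length)
-- and then either cancels an existing factor (1 2)(c n) or merges with it into
-- an embedded generator times a new (1 2)(d n).
-- The two shapes are told apart by whether n is fixed, and ι x · (1 2)(c n)
-- determines x.  Applying the normal form to a shortest expression gives the
-- inclusion of A(n,m) in the union; applying it to a hypothetical shorter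
-- expression gives minimality of the obvious expressions of the elements of
-- the two parts; and the fixed-point criterion gives disjointness.

module Submission where

open import Defs
open import Data.Nat using (ℕ; _+_)
open import Data.Product using (_×_)
open import Data.Sum using (_⊎_)
open import Relation.Nullary using (¬_)

import Data.Nat as ℕ
open import Data.Nat using (zero; suc; _<_; z≤n; s≤s)
open import Data.Nat.Properties using (+-comm; ≤-pred; <⇒≱)
open import Data.Fin as F using (Fin; toℕ; inject₁; fromℕ)
open import Data.Fin.Properties
  using (toℕ-fromℕ; toℕ-inject₁; toℕ-inject₁-≢; toℕ<n; lower₁-inject₁′;
         fromℕ≢inject₁; inject₁-injective; <-cmp; <⇒≢; ≤fromℕ)
open import Data.List using (List; []; _∷_; length; map; _++_)
open import Data.List.Properties using (length-map; length-++)
open import Data.List.Relation.Unary.All as All using (All; []; _∷_)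
open import Data.List.Relation.Unary.All.Properties using (map⁺; ++⁺)
open import Data.Product using (Σ; _,_)
open import Data.Sum using (inj₁; inj₂; [_,_])
open import Data.Empty using (⊥-elim)
open import Relation.Nullary using (yes; no)
open import Relation.Binary.Definitions using (tri<; tri≈; tri>)
open import Relation.Binary.PropositionalEquality
  using (_≡_; _≢_; _≗_; refl; sym; trans; cong; cong₂; subst; subst₂; module ≡-Reasoning)
open import Function using (_∘_; id)

-- Invertible maps

record Invertible {N : ℕ} (f : Perm N) : Set where
  field
    inverse       : Perm N
    left-inverse  : ∀ x → inverse (f x) ≡ x
    right-inverse : ∀ y → f (inverse y) ≡ y

  injective : ∀ {x y} → f x ≡ f y → x ≡ y
  injective {x} {y} e = trans (sym (left-inverse x)) (trans (cong inverse e) (left-inverse y))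

open Invertible

module _ {N : ℕ} where

  involution-invertible : {f : Perm N} → (∀ x → f (f x) ≡ x) → Invertible f
  involution-invertible {f} f² = record { inverse = f ; left-inverse = f² ; right-inverse = f² }

  id-invertible : Invertible {N} id
  id-invertible = involution-invertible (λ _ → refl)

  ∘-invertible : {f g : Perm N} → Invertible f → Invertible g → Invertible (f ∘ g)
  ∘-invertible {f} {g} F G = record
    { inverse       = inverse G ∘ inverse F
    ; left-inverse  = λ x → trans (cong (inverse G) (left-inverse F (g x))) (left-inverse G x)
    ; right-inverse = λ y → trans (cong f (right-inverse G (inverse F y))) (right-inverse F y)
    }

  ≗-invertible : {f g : Perm N} → f ≗ g → Invertible g → Invertible f
  ≗-invertible {f} {g} f≗g G = record
    { inverse       = inverse G
    ; left-inverse  = λ x → trans (cong (inverse G) (f≗g x)) (left-inverse G x)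
    ; right-inverse = λ y → trans (f≗g _) (right-inverse G y)
    }

-- Transpositions

module _ {N : ℕ} where

  data SwapView (i j x : Fin N) : Set where
    at-i  : x ≡ i → swap i j x ≡ j → SwapView i j x
    at-j  : x ≡ j → swap i j x ≡ i → SwapView i j x
    other : x ≢ i → x ≢ j → swap i j x ≡ x → SwapView i j x

  swap-at-i : (i j : Fin N) → swap i j i ≡ j
  swap-at-i i j with i F.≟ i
  ... | yes _ = refl
  ... | no i≢i = ⊥-elim (i≢i refl)

  swap-at-j : (i j : Fin N) → swap i j j ≡ i
  swap-at-j i j with j F.≟ i
  ... | yes j≡i = j≡i
  ... | no _ with j F.≟ j
  ...   | yes _ = refl
  ...   | no j≢j = ⊥-elim (j≢j refl)

  swap-other : (i j x : Fin N) → x ≢ i → x ≢ j → swap i j x ≡ x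
  swap-other i j x x≢i x≢j with x F.≟ i
  ... | yes x≡i = ⊥-elim (x≢i x≡i)
  ... | no _ with x F.≟ j
  ...   | yes x≡j = ⊥-elim (x≢j x≡j)
  ...   | no _ = refl

  swap-view : (i j x : Fin N) → SwapView i j x
  swap-view i j x with x F.≟ i
  ... | yes refl = at-i refl (swap-at-i i j)
  ... | no x≢i with x F.≟ j
  ...   | yes refl = at-j refl (swap-at-j i j)
  ...   | no x≢j = other x≢i x≢j (swap-other i j x x≢i x≢j)

  swap-involutive : (i j x : Fin N) → swap i j (swap i j x) ≡ x
  swap-involutive i j x with swap-view i j x
  ... | at-i refl e = trans (cong (swap i j) e) (swap-at-j i j)
  ... | at-j refl e = trans (cong (swap i j) e) (swap-at-i i j)
  ... | other _ _ e = trans (cong (swap i j) e) e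

  swap-sym : (i j : Fin N) → swap i j ≗ swap j i
  swap-sym i j x with swap-view i j x
  ... | at-i refl e = trans e (sym (swap-at-j j i))
  ... | at-j refl e = trans e (sym (swap-at-i j i))
  ... | other x≢i x≢j e = trans e (sym (swap-other j i x x≢j x≢i))

  swap-invertible : (i j : Fin N) → Invertible (swap i j)
  swap-invertible i j = involution-invertible (swap-involutive i j)

swap-conj : ∀ {M N} (g : Fin M → Fin N) → (∀ {x y} → g x ≡ g y → x ≡ y) →
  (a b x : Fin M) → g (swap a b x) ≡ swap (g a) (g b) (g x)
swap-conj g g-inj a b x with swap-view a b x
... | at-i refl e = trans (cong g e) (sym (swap-at-i (g a) (g b)))
... | at-j refl e = trans (cong g e) (sym (swap-at-j (g a) (g b)))
... | other x≢a x≢b e =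
  trans (cong g e) (sym (swap-other (g a) (g b) (g x) (x≢a ∘ g-inj) (x≢b ∘ g-inj)))

module _ {N : ℕ} where

  swap-past-involution : (g : Perm N) → (∀ x → g (g x) ≡ x) →
    (a b : Fin N) → swap a b ∘ g ≗ g ∘ swap (g a) (g b)
  swap-past-involution g g² a b x = begin
    swap a b (g x)                   ≡⟨ sym (g² _) ⟩
    g (g (swap a b (g x)))           ≡⟨ cong g (swap-conj g (injective (involution-invertible g²)) a b (g x)) ⟩
    g (swap (g a) (g b) (g (g x)))   ≡⟨ cong (g ∘ swap (g a) (g b)) (g² x) ⟩
    g (swap (g a) (g b) x)           ∎
    where open ≡-Reasoning

  swap-triangle : (c d l : Fin N) → c ≢ d → c ≢ l → swap d l ∘ swap c l ≗ swap c d ∘ swap d l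
  swap-triangle c d l c≢d c≢l x =
    trans (swap-conj (swap d l) (injective (swap-invertible d l)) c l x)
          (cong₂ (λ u w → swap u w (swap d l x)) (swap-other d l c c≢d c≢l) (swap-at-j d l))

-- The embedding ι : Sym(n) → Sym(n+1) fixing the last point

data LastOrInner {n : ℕ} : Fin (suc n) → Set where
  last  : LastOrInner (fromℕ n)
  inner : (p : Fin n) → LastOrInner (inject₁ p)

last-or-inner : ∀ {n} (x : Fin (suc n)) → LastOrInner x
last-or-inner {zero}  F.zero    = last
last-or-inner {suc n} F.zero    = inner F.zero
last-or-inner {suc n} (F.suc x) with last-or-inner x
... | last    = last
... | inner p = inner (F.suc p)

module _ {n : ℕ} where

  ι-last : (σ : Perm n) → ι σ (fromℕ n) ≡ fromℕ n
  ι-last σ with toℕ (fromℕ n) ℕ.≟ n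
  ... | yes _ = refl
  ... | no ≢n = ⊥-elim (≢n (toℕ-fromℕ n))

  ι-inner : (σ : Perm n) (p : Fin n) → ι σ (inject₁ p) ≡ inject₁ (σ p)
  ι-inner σ p with toℕ (inject₁ p) ℕ.≟ n
  ... | yes ≡n = ⊥-elim (toℕ-inject₁-≢ p (sym ≡n))
  ... | no ≢n = cong (inject₁ ∘ σ) (lower₁-inject₁′ p (≢n ∘ sym))

  ι-cong : {f g : Perm n} → f ≗ g → ι f ≗ ι g
  ι-cong {f} {g} f≗g x with last-or-inner x
  ... | last    = trans (ι-last f) (sym (ι-last g))
  ... | inner p = trans (ι-inner f p) (trans (cong inject₁ (f≗g p)) (sym (ι-inner g p)))

  ι-id : ι id ≗ id
  ι-id x with last-or-inner x
  ... | last    = ι-last id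
  ... | inner p = ι-inner id p

  ι-∘ : (f g : Perm n) → ι (f ∘ g) ≗ ι f ∘ ι g
  ι-∘ f g x with last-or-inner x
  ... | last    = trans (ι-last (f ∘ g)) (sym (trans (cong (ι f) (ι-last g)) (ι-last f)))
  ... | inner p = trans (ι-inner (f ∘ g) p) (sym (trans (cong (ι f) (ι-inner g p)) (ι-inner f (g p))))

  ι-swap : (a b : Fin n) → ι (swap a b) ≗ swap (inject₁ a) (inject₁ b)
  ι-swap a b x with last-or-inner x
  ... | last    = trans (ι-last _) (sym (swap-other _ _ _ fromℕ≢inject₁ fromℕ≢inject₁))
  ... | inner p = trans (ι-inner _ p) (swap-conj inject₁ inject₁-injective a b p)

  ι-invertible : {f : Perm n} → Invertible f → Invertible (ι f)
  ι-invertible {f} F = record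
    { inverse       = ι (inverse F)
    ; left-inverse  = λ x → trans (sym (ι-∘ (inverse F) f x)) (trans (ι-cong (left-inverse F) x) (ι-id x))
    ; right-inverse = λ y → trans (sym (ι-∘ f (inverse F) y)) (trans (ι-cong (right-inverse F) y) (ι-id y))
    }

  ι-reflects-≗ : {f g : Perm n} → ι f ≗ ι g → f ≗ g
  ι-reflects-≗ {f} {g} e p =
    inject₁-injective (trans (sym (ι-inner f p)) (trans (e (inject₁ p)) (ι-inner g p)))

-- Products of generators of T(A_{2+k})

module _ {k : ℕ} where

  s : Perm (2 + k)
  s = swap one two

  s-involutive : ∀ x → s (s x) ≡ x
  s-involutive = swap-involutive one two

  InT-≗ : {t u : Perm (2 + k)} → t ≗ u → InT u → InT t
  InT-≗ t≗u (a , b , a<b , u≗) = a , b , a<b , λ x → trans (t≗u x) (u≗ x)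

  InT-swap : (a b : Fin (2 + k)) → a ≢ b → InT (s ∘ swap a b)
  InT-swap a b a≢b with <-cmp a b
  ... | tri< a<b _ _ = a , b , a<b , λ _ → refl
  ... | tri≈ _ a≡b _ = ⊥-elim (a≢b a≡b)
  ... | tri> _ _ b<a = b , a , b<a , λ x → cong s (swap-sym a b x)

  InT-id : InT id
  InT-id = one , two , s≤s z≤n , λ x → sym (s-involutive x)

  InT-invertible : {t : Perm (2 + k)} → InT t → Invertible t
  InT-invertible (a , b , _ , t≗) =
    ≗-invertible t≗ (∘-invertible (swap-invertible one two) (swap-invertible a b))

  InT-swap·s : (a b : Fin (2 + k)) → a ≢ b → InT (swap a b ∘ s)
  InT-swap·s a b a≢b =
    InT-≗ (swap-past-involution s s-involutive a b) (InT-swap (s a) (s b) (a≢b ∘ injective (swap-invertible one two)))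

  InT-conj : {t : Perm (2 + k)} → InT t → InT (s ∘ t ∘ s)
  InT-conj (a , b , a<b , t≗) =
    InT-≗ (λ x → trans (cong s (t≗ (s x))) (s-involutive _)) (InT-swap·s a b (<⇒≢ a<b))

  TProd-≗ : ∀ {j} {v w : Perm (2 + k)} → v ≗ w → TProd j w → TProd j v
  TProd-≗ v≗w (ts , len , ps , w≗) = ts , len , ps , λ x → trans (v≗w x) (w≗ x)

  TProd-id : TProd {k} 0 id
  TProd-id = [] , refl , [] , λ _ → refl

  prod-++ : (ts us : List (Perm (2 + k))) → prod (ts ++ us) ≗ prod ts ∘ prod us
  prod-++ []       us x = refl
  prod-++ (t ∷ ts) us x = cong t (prod-++ ts us x)

  TProd-∘ : ∀ {i j} {v w : Perm (2 + k)} → TProd i v → TProd j w → TProd (i + j) (v ∘ w)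
  TProd-∘ {v = v} (ts , refl , ps , v≗) (us , refl , qs , w≗) =
    ts ++ us , length-++ ts , ++⁺ ps qs ,
    λ x → trans (v≗ _) (trans (cong (prod ts) (w≗ x)) (sym (prod-++ ts us x)))

  TProd-single : {t : Perm (2 + k)} → InT t → TProd 1 t
  TProd-single {t} p = t ∷ [] , refl , p ∷ [] , λ _ → refl

  TProd-cons : ∀ {j} {t v : Perm (2 + k)} → InT t → TProd j v → TProd (suc j) (t ∘ v)
  TProd-cons p = TProd-∘ (TProd-single p)

  TProd-snoc : ∀ {j} {v t : Perm (2 + k)} → TProd j v → InT t → TProd (suc j) (v ∘ t)
  TProd-snoc {j} {v} {t} q p = subst (λ i → TProd i (v ∘ t)) (+-comm j 1) (TProd-∘ q (TProd-single p))

  TProd-pad : ∀ {j} {v : Perm (2 + k)} → TProd j v → TProd (suc j) v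
  TProd-pad = TProd-cons InT-id

  TProd-invertible : ∀ {j} {v : Perm (2 + k)} → TProd j v → Invertible v
  TProd-invertible (ts , _ , ps , v≗) = ≗-invertible v≗ (go ts ps)
    where
    go : (ts : List (Perm (2 + k))) → All InT ts → Invertible (prod ts)
    go []       []       = id-invertible
    go (t ∷ ts) (p ∷ ps) = ∘-invertible (InT-invertible p) (go ts ps)

  T-word-even : (ts : List (Perm (2 + k))) → All InT ts →
    Σ (List (Perm (2 + k))) λ us → All IsTransposition us × Even (length us) × (prod ts ≗ prod us)
  T-word-even []       []       = [] , [] , ev0 , λ _ → refl
  T-word-even (t ∷ ts) ((a , b , a<b , t≗) ∷ ps) with T-word-even ts ps
  ... | us , us-tr , us-even , ts≗us =
    s ∷ swap a b ∷ us ,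
    (one , two , (λ ()) , λ _ → refl) ∷ (a , b , <⇒≢ a<b , λ _ → refl) ∷ us-tr ,
    ev2 us-even ,
    λ x → trans (t≗ _) (cong (s ∘ swap a b) (ts≗us x))

  TProd-even : ∀ {j} {v : Perm (2 + k)} → TProd j v → InAlt v
  TProd-even (ts , _ , ps , v≗) with T-word-even ts ps
  ... | us , us-tr , us-even , ts≗us = us , us-tr , us-even , λ x → trans (v≗ x) (ts≗us x)

A-intro : ∀ {k m} {v : Perm (2 + k)} → TProd m v → (∀ j → j < m → ¬ TProd j v) → A k m v
A-intro p minimal = TProd-even p , p , minimal

TProd-map : ∀ {k k′} (φ : Perm (2 + k) → Perm (2 + k′)) →
  (∀ {t} → InT t → InT (φ t)) → (∀ {f g} → f ≗ g → φ f ≗ φ g) →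
  φ id ≗ id → (∀ f g → φ (f ∘ g) ≗ φ f ∘ φ g) →
  ∀ {j v} → TProd j v → TProd j (φ v)
TProd-map φ φ-T φ-cong φ-id φ-∘ (ts , refl , ps , v≗) =
  map φ ts , length-map φ ts , map⁺ (All.map φ-T ps) , λ x → trans (φ-cong v≗ x) (φ-prod ts x)
  where
  φ-prod : ∀ ts → φ (prod ts) ≗ prod (map φ ts)
  φ-prod []       = φ-id
  φ-prod (t ∷ ts) x = trans (φ-∘ t (prod ts) x) (cong (φ t) (φ-prod ts x))

module _ {k : ℕ} where

  TProd-conj : ∀ {j} {v : Perm (2 + k)} → TProd j v → TProd j (s ∘ v ∘ s)
  TProd-conj = TProd-map (λ f → s ∘ f ∘ s) InT-conj (λ f≗g x → cong s (f≗g (s x))) s-involutive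
    (λ f g x → cong (s ∘ f) (sym (s-involutive (g (s x)))))

  ι-InT : {t : Perm (2 + k)} → InT t → InT {suc k} (ι t)
  ι-InT (a , b , a<b , t≗) =
    inject₁ a , inject₁ b , subst₂ _<_ (sym (toℕ-inject₁ a)) (sym (toℕ-inject₁ b)) a<b ,
    λ x → trans (ι-cong t≗ x) (trans (ι-∘ s (swap a b) x)
            (trans (ι-swap {2 + k} one two (ι (swap a b) x)) (cong s (ι-swap a b x))))

  TProd-ι : ∀ {j} {v : Perm (2 + k)} → TProd j v → TProd {suc k} j (ι v)
  TProd-ι = TProd-map ι ι-InT ι-cong ι-id ι-∘

-- The coset decomposition of products of generators of T(A_n), n = 3 + k

module Decomposition {k : ℕ} where

  L : Fin (3 + k)
  L = fromℕ (2 + k)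

  inner<L : (c : Fin (2 + k)) → inject₁ c F.< L
  inner<L c = subst₂ _<_ (sym (toℕ-inject₁ c)) (sym (toℕ-fromℕ (2 + k))) (toℕ<n c)

  nothing-above-L : (x : Fin (3 + k)) → ¬ (L F.< x)
  nothing-above-L x L<x = <⇒≱ L<x (≤fromℕ x)

  R : Fin (2 + k) → Perm (3 + k)
  R c = s ∘ swap (inject₁ c) L

  s-last : s L ≡ L
  s-last = swap-other one two L (λ ()) (λ ())

  ι-s : ι (s {k}) ≗ s
  ι-s = ι-swap one two

  s-inner : (p : Fin (2 + k)) → s (inject₁ p) ≡ inject₁ (s p)
  s-inner p = trans (sym (ι-s (inject₁ p))) (ι-inner s p)

  ι-conj-s : (y : Perm (2 + k)) → ι (s ∘ y ∘ s) ≗ s ∘ ι y ∘ s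
  ι-conj-s y x = begin
    ι (s ∘ y ∘ s) x     ≡⟨ ι-∘ s (y ∘ s) x ⟩
    ι s (ι (y ∘ s) x)   ≡⟨ ι-s (ι (y ∘ s) x) ⟩
    s (ι (y ∘ s) x)     ≡⟨ cong s (ι-∘ y s x) ⟩
    s (ι y (ι s x))     ≡⟨ cong (s ∘ ι y) (ι-s x) ⟩
    s (ι y (s x))       ∎
    where open ≡-Reasoning

  R-InT : (c : Fin (2 + k)) → InT (R c)
  R-InT c = inject₁ c , L , inner<L c , λ _ → refl

  R-InR : (c : Fin (2 + k)) → InR (R c)
  R-InR c = inj₁ (inject₁ c , inner<L c , λ _ → refl)

  R-invertible : (c : Fin (2 + k)) → Invertible (R c)
  R-invertible c = ∘-invertible (swap-invertible one two) (swap-invertible (inject₁ c) L)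

  R-to-last : (c : Fin (2 + k)) → R c (inject₁ c) ≡ L
  R-to-last c = trans (cong s (swap-at-i (inject₁ c) L)) s-last

  R-from-last : (c : Fin (2 + k)) → R c L ≡ inject₁ (s c)
  R-from-last c = trans (cong s (swap-at-j (inject₁ c) L)) (s-inner c)

  R-nontrivial : (c : Fin (2 + k)) → ¬ (R c ≗ id)
  R-nontrivial c R≗id = fromℕ≢inject₁ (sym (trans (sym (R-from-last c)) (R≗id L)))

  InR-R : {r : Perm (3 + k)} → InR r → ¬ (r ≗ id) → Σ (Fin (2 + k)) λ c → r ≗ R c
  InR-R (inj₂ r≗id) r≢id = ⊥-elim (r≢id r≗id)
  InR-R (inj₁ (j , j<L , r≗)) _ with last-or-inner j
  ... | last    = ⊥-elim (<⇒≢ j<L refl)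
  ... | inner c = c , r≗

  R-past-ι : {y : Perm (2 + k)} → Invertible y → {a b : Fin (2 + k)} → y b ≡ a →
    R a ∘ ι y ≗ ι (s ∘ y ∘ s) ∘ R b
  R-past-ι {y} Y {a} {b} yb≡a x = begin
    s (swap (inject₁ a) L (ι y x))                  ≡⟨ cong₂ (λ u w → s (swap u w (ι y x))) moved (sym (ι-last y)) ⟩
    s (swap (ι y (inject₁ b)) (ι y L) (ι y x))      ≡⟨ cong s (sym (swap-conj (ι y) (injective (ι-invertible Y)) _ _ x)) ⟩
    s (ι y z)                                       ≡⟨ cong (s ∘ ι y) (sym (s-involutive z)) ⟩
    s (ι y (s (s z)))                               ≡⟨ sym (ι-conj-s y (s z)) ⟩
    ι (s ∘ y ∘ s) (s z)                             ∎
    where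
    open ≡-Reasoning
    z = swap (inject₁ b) L x
    moved : inject₁ a ≡ ι y (inject₁ b)
    moved = sym (trans (ι-inner y b) (cong inject₁ yb≡a))

  R-R : (a c : Fin (2 + k)) → R a ∘ R c ≗ swap (inject₁ (s a)) L ∘ swap (inject₁ c) L
  R-R a c x = begin
    s (swap (inject₁ a) L (s w))               ≡⟨ cong s (swap-past-involution s s-involutive (inject₁ a) L w) ⟩
    s (s (swap (s (inject₁ a)) (s L) w))       ≡⟨ s-involutive _ ⟩
    swap (s (inject₁ a)) (s L) w               ≡⟨ cong₂ (λ u v → swap u v w) (s-inner a) s-last ⟩
    swap (inject₁ (s a)) L w                   ∎
    where
    open ≡-Reasoning
    w = swap (inject₁ c) L x

  R-R-cancel : (a c : Fin (2 + k)) → s a ≡ c → R a ∘ R c ≗ id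
  R-R-cancel a c refl x = trans (R-R a c x) (swap-involutive (inject₁ (s a)) L x)

  R-R-merge : (a c : Fin (2 + k)) → c ≢ s a → R a ∘ R c ≗ ι (swap c (s a) ∘ s) ∘ R (s a)
  R-R-merge a c c≢d x = begin
    R a (R c x)                                     ≡⟨ R-R a c x ⟩
    swap (inject₁ d) L (swap (inject₁ c) L x)       ≡⟨ swap-triangle (inject₁ c) (inject₁ d) L (c≢d ∘ inject₁-injective)
                                                         (fromℕ≢inject₁ ∘ sym) x ⟩
    swap (inject₁ c) (inject₁ d) y                  ≡⟨ sym (ι-swap c d y) ⟩
    ι (swap c d) y                                  ≡⟨ cong (ι (swap c d)) (sym (s-involutive y)) ⟩
    ι (swap c d) (s (s y))                          ≡⟨ cong (ι (swap c d)) (sym (ι-s (R d x))) ⟩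
    ι (swap c d) (ι s (R d x))                      ≡⟨ sym (ι-∘ (swap c d) s (R d x)) ⟩
    ι (swap c d ∘ s) (R d x)                        ∎
    where
    open ≡-Reasoning
    d = s a
    y = swap (inject₁ d) L x

  data Split : ℕ → Perm (3 + k) → Set where
    embedded  : ∀ {j v} (y : Perm (2 + k)) → TProd j y → v ≗ ι y → Split j v
    through-R : ∀ {j v} (y : Perm (2 + k)) (c : Fin (2 + k)) → TProd j y → v ≗ ι y ∘ R c →
                Split (suc j) v

  Split-≗ : ∀ {j} {v w : Perm (3 + k)} → v ≗ w → Split j w → Split j v
  Split-≗ v≗w (embedded y p w≗)    = embedded y p (λ x → trans (v≗w x) (w≗ x))
  Split-≗ v≗w (through-R y c p w≗) = through-R y c p (λ x → trans (v≗w x) (w≗ x))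

  Split-ι : ∀ {j} {t : Perm (2 + k)} {v : Perm (3 + k)} → InT t → Split j v → Split (suc j) (ι t ∘ v)
  Split-ι {t = t} p (embedded y q v≗) =
    embedded (t ∘ y) (TProd-cons p q) λ x → trans (cong (ι t) (v≗ x)) (sym (ι-∘ t y x))
  Split-ι {t = t} p (through-R y c q v≗) =
    through-R (t ∘ y) c (TProd-cons p q) λ x → trans (cong (ι t) (v≗ x)) (sym (ι-∘ t y (R c x)))

  Split-R : ∀ {j} {v : Perm (3 + k)} (a : Fin (2 + k)) → Split j v → Split (suc j) (R a ∘ v)
  Split-R a (embedded y q v≗) =
    through-R (s ∘ y ∘ s) (inverse Y a) (TProd-conj q) λ x →
      trans (cong (R a) (v≗ x)) (R-past-ι Y (right-inverse Y a) x)
    where Y = TProd-invertible q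
  Split-R {v = v} a (through-R {j} y c q v≗) = combine (inverse Y a) (right-inverse Y a)
    where
    Y = TProd-invertible q
    combine : (b : Fin (2 + k)) → y b ≡ a → Split (suc (suc j)) (R a ∘ v)
    combine b yb≡a with s b F.≟ c
    ... | yes sb≡c = embedded (s ∘ y ∘ s) (TProd-pad (TProd-pad (TProd-conj q))) λ x → begin
      R a (v x)                       ≡⟨ cong (R a) (v≗ x) ⟩
      R a (ι y (R c x))               ≡⟨ R-past-ι Y yb≡a (R c x) ⟩
      ι (s ∘ y ∘ s) (R b (R c x))     ≡⟨ cong (ι (s ∘ y ∘ s)) (R-R-cancel b c sb≡c x) ⟩
      ι (s ∘ y ∘ s) x                 ∎
      where open ≡-Reasoning
    ... | no sb≢c = through-R (s ∘ y ∘ s ∘ t) (s b) (TProd-snoc (TProd-conj q) t-InT) λ x → begin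
      R a (v x)                               ≡⟨ cong (R a) (v≗ x) ⟩
      R a (ι y (R c x))                       ≡⟨ R-past-ι Y yb≡a (R c x) ⟩
      ι (s ∘ y ∘ s) (R b (R c x))             ≡⟨ cong (ι (s ∘ y ∘ s)) (R-R-merge b c (sb≢c ∘ sym) x) ⟩
      ι (s ∘ y ∘ s) (ι t (R (s b) x))         ≡⟨ sym (ι-∘ (s ∘ y ∘ s) t (R (s b) x)) ⟩
      ι (s ∘ y ∘ s ∘ t) (R (s b) x)           ∎
      where
      open ≡-Reasoning
      t = swap c (s b) ∘ s
      t-InT : InT t
      t-InT = InT-swap·s c (s b) (sb≢c ∘ sym)

  Split-step : ∀ {j} {t v : Perm (3 + k)} → InT t → Split j v → Split (suc j) (t ∘ v)
  Split-step {v = v} (a , b , a<b , t≗) sv with last-or-inner a | last-or-inner b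
  ... | last     | _        = ⊥-elim (nothing-above-L b a<b)
  ... | inner a′ | last     = Split-≗ (λ x → t≗ (v x)) (Split-R a′ sv)
  ... | inner a′ | inner b′ = Split-≗ (λ x → trans (t≗ (v x)) (sym (ι-t (v x)))) (Split-ι t′-InT sv)
    where
    t′-InT : InT (s ∘ swap a′ b′)
    t′-InT = a′ , b′ , subst₂ _<_ (toℕ-inject₁ a′) (toℕ-inject₁ b′) a<b , λ _ → refl
    ι-t : ι (s ∘ swap a′ b′) ≗ s ∘ swap (inject₁ a′) (inject₁ b′)
    ι-t x = trans (ι-∘ s (swap a′ b′) x) (trans (ι-s (ι (swap a′ b′) x)) (cong s (ι-swap a′ b′ x)))

  split : ∀ {j} {v : Perm (3 + k)} → TProd j v → Split j v
  split (ts , refl , ps , v≗) = Split-≗ v≗ (go ts ps)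
    where
    go : (ts : List (Perm (3 + k))) → All InT ts → Split (length ts) (prod ts)
    go []       []       = embedded id TProd-id (λ x → sym (ι-id x))
    go (t ∷ ts) (p ∷ ps) = Split-step p (go ts ps)

module Parts {k : ℕ} where
  open Decomposition {k}

  ι-only-last : (y : Perm (2 + k)) {z : Fin (3 + k)} → ι y z ≡ L → z ≡ L
  ι-only-last y {z} e with last-or-inner z
  ... | last    = refl
  ... | inner p = ⊥-elim (fromℕ≢inject₁ (trans (sym e) (ι-inner y p)))

  ιR-moves-last : (y : Perm (2 + k)) (c : Fin (2 + k)) → ι y (R c L) ≢ L
  ιR-moves-last y c e = fromℕ≢inject₁ (trans (sym e) (trans (cong (ι y) (R-from-last c)) (ι-inner y (s c))))

  ιR-preimage-last : (x : Perm (2 + k)) (c : Fin (2 + k)) {z : Fin (3 + k)} →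
    ι x (R c z) ≡ L → z ≡ inject₁ c
  ιR-preimage-last x c e = injective (R-invertible c) (trans (ι-only-last x e) (sym (R-to-last c)))

  -- ι x · (1 2)(c n) determines x: the point sent to n determines c, and then
  -- (1 2)(c n) can be cancelled.
  ιR-cancel : {x y : Perm (2 + k)} {c c′ : Fin (2 + k)} → ι x ∘ R c ≗ ι y ∘ R c′ → x ≗ y
  ιR-cancel {x} {y} {c} {c′} e
    with inject₁-injective {i = c} (ιR-preimage-last y c′
           (trans (sym (e (inject₁ c))) (trans (cong (ι x) (R-to-last c)) (ι-last x))))
  ... | refl = ι-reflects-≗ λ z → begin
    ι x z                            ≡⟨ cong (ι x) (sym (right-inverse Rc z)) ⟩
    ι x (R c (inverse Rc z))         ≡⟨ e (inverse Rc z) ⟩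
    ι y (R c (inverse Rc z))         ≡⟨ cong (ι y) (right-inverse Rc z) ⟩
    ι y z                            ∎
    where
    open ≡-Reasoning
    Rc = R-invertible c

  left-shape : ∀ {m} {v : Perm (3 + k)} → LeftPart k (suc m) v →
    Σ (Perm (2 + k)) λ x → Σ (Fin (2 + k)) λ c → A k m x × (v ≗ ι x ∘ R c)
  left-shape (x , r , x∈A , r∈R , r≢e , v≗) with InR-R r∈R r≢e
  ... | c , r≗ = x , c , x∈A , λ z → trans (v≗ z) (cong (ι x) (r≗ z))

  -- A(n-1, m) ⊆ A(n, m): a shorter expression of ι x would have to fix n,
  -- hence come from a shorter expression of x.
  right-in-A : ∀ m (v : Perm (3 + k)) → RightPart k m v → A (1 + k) m v
  right-in-A m v (x , (_ , p , x-minimal) , v≗) = A-intro (TProd-≗ v≗ (TProd-ι p)) v-minimal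
    where
    v-minimal : ∀ j → j < m → ¬ TProd j v
    v-minimal j j<m q with split q
    ... | embedded y q′ v≗′ =
      x-minimal j j<m (TProd-≗ (ι-reflects-≗ λ z → trans (sym (v≗ z)) (v≗′ z)) q′)
    ... | through-R y c _ v≗′ =
      ιR-moves-last y c (trans (sym (v≗′ L)) (trans (v≗ L) (ι-last x)))

  -- A(n-1, m-1)·(R_n ∖ {e}) ⊆ A(n, m): a shorter expression of ι x · (1 2)(c n)
  -- would have to move n, hence give a shorter expression of x.
  left-in-A : ∀ m (v : Perm (3 + k)) → LeftPart k m v → A (1 + k) m v
  left-in-A zero    v ()
  left-in-A (suc m) v l with left-shape l
  ... | x , c , (_ , p , x-minimal) , v≗ =
    A-intro (TProd-≗ v≗ (TProd-snoc (TProd-ι p) (R-InT c))) v-minimal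
    where
    v-minimal : ∀ j → j < suc m → ¬ TProd j v
    v-minimal j j<1+m q with split q
    ... | embedded y _ v≗′ =
      ιR-moves-last x c (trans (sym (v≗ L)) (trans (v≗′ L) (ι-last y)))
    ... | through-R {j′} y c′ q′ v≗′ =
      x-minimal j′ (≤-pred j<1+m) (TProd-≗ (ιR-cancel λ z → trans (sym (v≗ z)) (v≗′ z)) q′)

  A-split : ∀ m (v : Perm (3 + k)) → A (1 + k) m v → LeftPart k m v ⊎ RightPart k m v
  A-split m v (_ , p , v-minimal) with split p
  ... | embedded y q v≗ =
    inj₂ (y , A-intro q (λ j j<m q′ → v-minimal j j<m (TProd-≗ v≗ (TProd-ι q′))) , v≗)
  ... | through-R {m′} y c q v≗ =
    inj₁ (y , R c , A-intro q y-minimal , R-InR c , R-nontrivial c , v≗)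
    where
    y-minimal : ∀ j → j < m′ → ¬ TProd j y
    y-minimal j j<m q′ = v-minimal (suc j) (s≤s j<m) (TProd-≗ v≗ (TProd-snoc (TProd-ι q′) (R-InT c)))

  -- The two parts are separated by whether n is fixed.
  parts-disjoint : ∀ m (v : Perm (3 + k)) → ¬ (LeftPart k m v × RightPart k m v)
  parts-disjoint zero    v (() , _)
  parts-disjoint (suc m) v (l , (y , _ , v≗′)) with left-shape l
  ... | x , c , _ , v≗ = ιR-moves-last x c (trans (sym (v≗ L)) (trans (v≗′ L) (ι-last y)))

theorem5p3 : (k m : ℕ) → (v : Perm (3 + k)) →
    ((A (1 + k) m v → LeftPart k m v ⊎ RightPart k m v)
      × (LeftPart k m v ⊎ RightPart k m v → A (1 + k) m v))
    × ¬ (LeftPart k m v × RightPart k m v)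
theorem5p3 k m v = (A-split m v , [ left-in-A m v , right-in-A m v ]) , parts-disjoint m v
  where open Parts {k}
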